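{- Let $R\in\mathfrak{D}$, let $\mathfrak{D}'\subseteq\mathfrak{D}$, and let $\mathcal{E}(R)$ be the EV-system of $R$ with respect to $\mathfrak{D}'$. Then for all $\mathfrak{a},\mathfrak{b}\in\mathcal{E}_o(R)$: 1. if $\mathfrak{a}\mathfrak{b}\in A(\mathcal{E}(R))$, then $\mathfrak{a}_1\mathfrak{b}_1\in A(R)$; 2. if $\mathfrak{a}\mathfrak{b}\in A(\mathcal{E}(R)^*)$, then $\mathfrak{a}_1\mathfrak{b}_1\in A(R^*)$, $\mathfrak{a}_1\in\mathfrak{b}_2$ and $\mathfrak{b}_1\in\mathfrak{a}_3$; 3. if $\mathfrak{a}\mathfrak{b}\in A(\mathcal{E}(R))$ and $\mathfrak{a}_1=\mathfrak{b}_1$, then $\mathfrak{a}=\mathfrak{b}$. Furthermore, if $R^*$ contains no closed walk, then $\mathcal{E}(R)^*$ contains no closed walk.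
   Context: Digraphs $G=(V(G),A(G))$ have a finite nonempty vertex set, and $A(G)\subseteq V(G)\times V(G)$; loops are allowed. $G^*$ is $G$ with loops removed. A closed walk is a sequence $v_0,\dots,v_I$ with $I\ge1$, $v_{i-1}v_i\in A$ for all $i$, and $v_0=v_I$. $N^{in}_G(v)=\{w\ne v:wv\in A(G)\}$ and $N^{out}_G(v)=\{w\ne v:vw\in A(G)\}$. A homomorphism maps arcs to arcs; it is strict if, in addition, it maps proper arcs to proper arcs. $\mathcal{S}(G,H)$ is the set of strict homomorphisms. $\mathfrak{D}$ is a representative system of the isomorphism classes of finite digraphs. EV-system of $R$ with respect to $\mathfrak{D}'$: - Vertex set $\mathcal{E}_o(R)=\{(v,D,U):v\in V(R),\ D\subseteq N^{in}_R(v),\ U\subseteq N^{out}_R(v)\}$, with components $\mathfrak{a}_1,\mathfrak{a}_2,\mathfrak{a}_3$. - $\alpha^R_{G,\xi}(v)=(\xi(v),\xi[N^{in}_G(v)],\xi[N^{out}_G(v)])$ for $G\in\mathfrak{D}'$ and $\xi\in\mathcal{S}(G,R)$. - $\mathfrak{a}\mathfrak{b}\in A(\mathcal{E}(R))$ iff there exist $G\in\mathfrak{D}'$, $\xi\in\mathcal{S}(G,R)$ and $vw\in A(G)$ with $\mathfrak{a}=\alpha^R_{G,\xi}(v)$ and $\mathfrak{b}=\alpha^R_{G,\xi}(w)$. -}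

module Defs where

open import Data.Nat using (ℕ; suc)
open import Data.Fin using (Fin; zero; _≟_)
open import Data.Fin.Subset using (Subset; _∈_)
open import Data.Fin.Subset.Properties using (_∈?_)
open import Data.Unit using (⊤)
open import Data.Fin.Properties using (any?)
open import Data.Bool using (Bool; T; not; _∧_)
open import Data.Vec using (tabulate)
open import Data.Product using (Σ; _×_; ∃; ∃-syntax)
open import Relation.Nullary using (¬_)
open import Relation.Nullary.Decidable using (⌊_⌋; _×-dec_)
open import Relation.Binary.PropositionalEquality using (_≡_; _≢_)

record Digraph : Set where
  field
    ord : ℕ
    arc : Fin (suc ord) → Fin (suc ord) → Bool

open Digraph public

V : Digraph → Set
V G = Fin (suc (ord G))

Arc : (G : Digraph) → V G → V G → Set
Arc G v w = T (arc G v w)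

Arc* : (G : Digraph) → V G → V G → Set
Arc* G v w = Arc G v w × v ≢ w

Nin : (G : Digraph) → V G → Subset (suc (ord G))
Nin G v = tabulate (λ w → not ⌊ w ≟ v ⌋ ∧ arc G w v)

Nout : (G : Digraph) → V G → Subset (suc (ord G))
Nout G v = tabulate (λ w → not ⌊ w ≟ v ⌋ ∧ arc G v w)

_⊆_ : ∀ {n} → Subset n → Subset n → Set
S ⊆ T' = ∀ x → x ∈ S → x ∈ T'

image : ∀ {m n} → (Fin m → Fin n) → Subset m → Subset n
image {m} ξ S = tabulate (λ y → ⌊ any? (λ x → (x ∈? S) ×-dec (ξ x ≟ y)) ⌋)

IsHom : (G H : Digraph) → (V G → V H) → Set
IsHom G H ξ = ∀ v w → Arc G v w → Arc H (ξ v) (ξ w)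

IsStrict : (G H : Digraph) → (V G → V H) → Set
IsStrict G H ξ = IsHom G H ξ × (∀ v w → Arc* G v w → Arc* H (ξ v) (ξ w))

-- candidate vertices (v , D , U) of the EV-system
Triple : Digraph → Set
Triple R = V R × Subset (suc (ord R)) × Subset (suc (ord R))

InEo : (R : Digraph) → Triple R → Set
InEo R (v Data.Product., D Data.Product., U) = D ⊆ Nin R v × U ⊆ Nout R v

α : (R G : Digraph) → (V G → V R) → V G → Triple R
α R G ξ v = ξ v Data.Product., image ξ (Nin G v) Data.Product., image ξ (Nout G v)

EArc : (𝔇' : Digraph → Set) (R : Digraph) → Triple R → Triple R → Set
EArc 𝔇' R a b =
  Σ Digraph λ G → 𝔇' G × Σ (V G → V R) λ ξ → IsStrict G R ξ ×
    ∃[ v ] ∃[ w ] (Arc G v w × a ≡ α R G ξ v × b ≡ α R G ξ w)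

EArc* : (𝔇' : Digraph → Set) (R : Digraph) → Triple R → Triple R → Set
EArc* 𝔇' R a b = EArc 𝔇' R a b × a ≢ b

HasClosedWalk : {X : Set} (P : X → Set) (A : X → X → Set) → Set
HasClosedWalk {X} P A =
  Σ ℕ λ k → Σ (Fin (suc (suc k)) → X) λ walk →
    (∀ i → P (walk i)) ×
    (∀ (i : Fin (suc k)) → A (walk (Data.Fin.inject₁ i)) (walk (Data.Fin.suc i))) ×
    walk zero ≡ walk (Data.Fin.fromℕ (suc k))

AllV : (R : Digraph) → V R → Set
AllV R _ = ⊤

-- An EV-arc is the image of an arc vw of some G under a strict homomorphism ξ : G → R.
-- If v = w both triples equal α(v); otherwise strictness makes ξv ξw a proper arc of R,
-- and v, w lie in each other's neighbourhoods, so ξv, ξw lie in the recorded images.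
-- Thus the first projection maps E(R)* into R*, and closed walks along with it.
module Submission where

open import Defs
open import Data.Bool using (Bool; true; not; _∧_)
open import Data.Bool.Properties using (T-≡)
open import Data.Empty using (⊥-elim)
open import Data.Fin using (Fin; _≟_)
open import Data.Fin.Subset using (Subset; _∈_)
open import Data.Product using (_×_; _,_; proj₁; proj₂)
open import Data.Vec using (tabulate)
open import Data.Vec.Properties using (lookup∘tabulate; lookup⇒[]=)
open import Function using (_∘_)
open import Function.Bundles using (Equivalence)
open import Relation.Nullary using (¬_; yes; no)
open import Relation.Nullary.Decidable using (fromWitness; ⌊_⌋)
open import Relation.Binary.PropositionalEquality using (_≡_; _≢_; refl; sym; trans; cong)

∈-tabulate⁺ : ∀ {n} (f : Fin n → Bool) x → f x ≡ true → x ∈ tabulate f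
∈-tabulate⁺ f x fx = lookup⇒[]= x (tabulate f) (trans (lookup∘tabulate f x) fx)

∈-image⁺ : ∀ {m n} (ξ : Fin m → Fin n) {S : Subset m} {x} → x ∈ S → ξ x ∈ image ξ S
∈-image⁺ ξ {x = x} x∈S =
  ∈-tabulate⁺ _ (ξ x) (Equivalence.to T-≡ (fromWitness (x , x∈S , refl)))

module _ (G : Digraph) {v w : V G} (v≢w : v ≢ w) (vw : Arc G v w) where

  ∈-Nin⁺ : v ∈ Nin G w
  ∈-Nin⁺ = ∈-tabulate⁺ (λ u → not ⌊ u ≟ w ⌋ ∧ arc G u w) v (entry≡true (v ≟ w))
    where
    entry≡true : ∀ d → not ⌊ d ⌋ ∧ arc G v w ≡ true
    entry≡true (yes v≡w) = ⊥-elim (v≢w v≡w)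
    entry≡true (no _)    = Equivalence.to T-≡ vw

  ∈-Nout⁺ : w ∈ Nout G v
  ∈-Nout⁺ = ∈-tabulate⁺ (λ u → not ⌊ u ≟ v ⌋ ∧ arc G v u) w (entry≡true (w ≟ v))
    where
    entry≡true : ∀ d → not ⌊ d ⌋ ∧ arc G v w ≡ true
    entry≡true (yes w≡v) = ⊥-elim (v≢w (sym w≡v))
    entry≡true (no _)    = Equivalence.to T-≡ vw

module _ {𝔇' : Digraph → Set} (R : Digraph) where

  EArc⇒Arc : ∀ {a b} → EArc 𝔇' R a b → Arc R (proj₁ a) (proj₁ b)
  EArc⇒Arc (_ , _ , _ , (hom , _) , v , w , vw , refl , refl) = hom v w vw

  EArc*⇒Arc*-linked : ∀ {a b} → EArc* 𝔇' R a b →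
    Arc* R (proj₁ a) (proj₁ b) × proj₁ a ∈ proj₁ (proj₂ b) × proj₁ b ∈ proj₂ (proj₂ a)
  EArc*⇒Arc*-linked ((G , _ , ξ , (_ , strict) , v , w , vw , refl , refl) , a≢b)
    with v ≟ w
  ... | yes refl = ⊥-elim (a≢b refl)
  ... | no v≢w   = strict v w (vw , v≢w)
                 , ∈-image⁺ ξ (∈-Nin⁺ G v≢w vw)
                 , ∈-image⁺ ξ (∈-Nout⁺ G v≢w vw)

  EArc-proj₁-injective : ∀ {a b} → EArc 𝔇' R a b → proj₁ a ≡ proj₁ b → a ≡ b
  EArc-proj₁-injective (_ , _ , _ , (_ , strict) , v , w , vw , refl , refl) ξv≡ξw
    with v ≟ w
  ... | yes refl = refl
  ... | no v≢w   = ⊥-elim (proj₂ (strict v w (vw , v≢w)) ξv≡ξw)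

HasClosedWalk-map : {X Y : Set} {P : X → Set} {Q : Y → Set}
  {A : X → X → Set} {B : Y → Y → Set} (f : X → Y) →
  (∀ {x} → P x → Q (f x)) → (∀ {x y} → A x y → B (f x) (f y)) →
  HasClosedWalk P A → HasClosedWalk Q B
HasClosedWalk-map f P⇒Q A⇒B (k , walk , onP , steps , closed) =
  k , f ∘ walk , P⇒Q ∘ onP , A⇒B ∘ steps , cong f closed

lemma1 : (R : Digraph) (𝔇' : Digraph → Set) →
    ((a b : Triple R) → InEo R a → InEo R b →
        (EArc 𝔇' R a b → Arc R (proj₁ a) (proj₁ b))
      × (EArc* 𝔇' R a b →
          Arc* R (proj₁ a) (proj₁ b)
          × proj₁ a ∈ proj₁ (proj₂ b)
          × proj₁ b ∈ proj₂ (proj₂ a))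
      × (EArc 𝔇' R a b → proj₁ a ≡ proj₁ b → a ≡ b))
    × (¬ HasClosedWalk (AllV R) (Arc* R) → ¬ HasClosedWalk (InEo R) (EArc* 𝔇' R))
lemma1 R 𝔇' =
    (λ _ _ _ _ → EArc⇒Arc R , EArc*⇒Arc*-linked R , EArc-proj₁-injective R)
  , λ noWalkR → noWalkR ∘ HasClosedWalk-map {P = InEo R} {A = EArc* 𝔇' R}
                            proj₁ _ (proj₁ ∘ EArc*⇒Arc*-linked R)
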